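{- If a prime $(2P_2,C_5,S_{1,1,2})$-free graph $G$ contains an induced subgraph isomorphic to the net, then $G$ is a thin spider.
   Context: All graphs are finite, simple and undirected. $G$ is $(H_1,\dots,H_p)$-free if it has no induced subgraph isomorphic to any $H_i$. $2P_2$ is the disjoint union of two edges, $C_5$ the 5-cycle, and $S_{1,1,2}$ the tree with exactly one vertex $x$ of degree 3 and three leaves at distances $1,1,2$ from $x$. The net is the graph on vertices $a_1,a_2,a_3,b_1,b_2,b_3$ where $b_1b_2b_3$ is a triangle, $a_1,a_2,a_3$ are pairwise non-adjacent, and the only other edges are $a_ib_i$ for $i=1,2,3$. A module of $G$ is a set $M$ of vertices such that every vertex outside $M$ is adjacent either to all or to none of $M$; it is trivial if it has zero, one, or all vertices; $G$ is prime if all its modules are trivial. A thin spider is a graph whose vertex set can be partitioned into a clique $K$, an independent set $I$ and a set $R$ such that $|K|=|I|\geq 2$, $R$ is complete to $K$ and anti-complete to $I$, and the edges between $K$ and $I$ form an induced matching (every vertex of $K$ has exactly one neighbour in $I$ and vice versa). -}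

module Defs where

open import Data.Bool using (Bool; true; false; _∧_; _∨_)
open import Data.Nat using (ℕ; _≤_; _≥_)
open import Data.Fin using (Fin; zero; suc; _≟_)
open import Data.Fin.Subset using (Subset; _∈_; _∉_; ∣_∣; ⊤)
open import Data.Vec using (tabulate)
open import Data.List using (List; []; _∷_)
open import Data.Bool.ListAction using (any)
open import Data.Product using (Σ; _×_; _,_; ∃)
open import Data.Sum using (_⊎_)
open import Relation.Nullary using (¬_)
open import Relation.Nullary.Decidable using (⌊_⌋)
open import Relation.Binary.PropositionalEquality using (_≡_)
open import Function.Definitions using (Injective)

Adj : ℕ → Set
Adj n = Fin n → Fin n → Bool

record Graph (n : ℕ) : Set where
  field
    adj    : Adj n
    sym    : ∀ u v → adj u v ≡ adj v u
    irrefl : ∀ v → adj v v ≡ false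
open Graph public

fromEdges : {k : ℕ} → List (Fin k × Fin k) → Adj k
fromEdges es i j = any (λ { (a , b) → (⌊ a ≟ i ⌋ ∧ ⌊ b ≟ j ⌋) ∨ (⌊ a ≟ j ⌋ ∧ ⌊ b ≟ i ⌋) }) es

ContainsInduced : {n k : ℕ} → Graph n → Adj k → Set
ContainsInduced {n} {k} G H =
  Σ (Fin k → Fin n) λ f → Injective _≡_ _≡_ f × (∀ i j → adj G (f i) (f j) ≡ H i j)

Free : {n k : ℕ} → Graph n → Adj k → Set
Free G H = ¬ ContainsInduced G H

2P2 : Adj 4
2P2 = fromEdges ((zero , suc zero) ∷ (suc (suc zero) , suc (suc (suc zero))) ∷ [])

private
  v0 v1 v2 v3 v4 v5 : {k : ℕ} → Fin (6 Data.Nat.+ k)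
  v0 = zero
  v1 = suc zero
  v2 = suc (suc zero)
  v3 = suc (suc (suc zero))
  v4 = suc (suc (suc (suc zero)))
  v5 = suc (suc (suc (suc (suc zero))))

C5 : Adj 5
C5 = fromEdges ((zero , suc zero) ∷ (suc zero , suc (suc zero))
              ∷ (suc (suc zero) , suc (suc (suc zero)))
              ∷ (suc (suc (suc zero)) , suc (suc (suc (suc zero))))
              ∷ (suc (suc (suc (suc zero))) , zero) ∷ [])

S112 : Adj 5
S112 = fromEdges ((zero , suc zero) ∷ (zero , suc (suc zero))
                ∷ (zero , suc (suc (suc zero)))
                ∷ (suc (suc (suc zero)) , suc (suc (suc (suc zero)))) ∷ [])

-- Net: b1=0, b2=1, b3=2 triangle; a1=3, a2=4, a3=5 with a_i b_i edges.
Net : Adj 6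
Net = fromEdges ((v0 , v1) ∷ (v1 , v2) ∷ (v0 , v2)
               ∷ (v0 , v3) ∷ (v1 , v4) ∷ (v2 , v5) ∷ [])

IsModule : {n : ℕ} → Graph n → Subset n → Set
IsModule {n} G M = ∀ (v : Fin n) → v ∉ M →
  (∀ u → u ∈ M → adj G v u ≡ true) ⊎ (∀ u → u ∈ M → adj G v u ≡ false)

TrivialModule : {n : ℕ} → Subset n → Set
TrivialModule M = ∣ M ∣ ≤ 1 ⊎ M ≡ ⊤

Prime : {n : ℕ} → Graph n → Set
Prime {n} G = ∀ (M : Subset n) → IsModule G M → TrivialModule M

data Part : Set where
  K I R : Part

isPart : Part → Part → Bool
isPart K K = true
isPart I I = true
isPart R R = true
isPart _ _ = false

partSet : {n : ℕ} → (Fin n → Part) → Part → Subset n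
partSet ℓ p = tabulate (λ v → isPart (ℓ v) p)

UniqueNbrIn : {n : ℕ} → Graph n → (Fin n → Part) → Part → Fin n → Set
UniqueNbrIn G ℓ p v =
  ∃ λ w → ℓ w ≡ p × adj G v w ≡ true
        × (∀ w' → ℓ w' ≡ p → adj G v w' ≡ true → w' ≡ w)

IsThinSpiderPartition : {n : ℕ} → Graph n → (Fin n → Part) → Set
IsThinSpiderPartition {n} G ℓ =
    ∣ partSet ℓ K ∣ ≡ ∣ partSet ℓ I ∣
  × ∣ partSet ℓ K ∣ ≥ 2
  × (∀ u v → ℓ u ≡ K → ℓ v ≡ K → ¬ u ≡ v → adj G u v ≡ true)
  × (∀ u v → ℓ u ≡ I → ℓ v ≡ I → adj G u v ≡ false)
  × (∀ u v → ℓ u ≡ R → ℓ v ≡ K → adj G u v ≡ true)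
  × (∀ u v → ℓ u ≡ R → ℓ v ≡ I → adj G u v ≡ false)
  × (∀ v → ℓ v ≡ K → UniqueNbrIn G ℓ I v)
  × (∀ v → ℓ v ≡ I → UniqueNbrIn G ℓ K v)

IsThinSpider : {n : ℕ} → Graph n → Set
IsThinSpider {n} G = Σ (Fin n → Part) λ ℓ → IsThinSpiderPartition G ℓ

module Submission where

-- Grow a partial thin spider: a labelling of the vertices by K, I, R such that K is a
-- clique, I is independent and the K–I edges form a perfect induced matching, whose edges
-- k_J i_J we call legs.  The net provides three legs (bₜ, aₜ).  A leg (r, z) can be added
-- whenever r ∈ R is complete to K and anticomplete to I and its neighbour z ∈ R is anticomplete
-- to K ∪ I; repeat until saturated.  It remains to show that R is then complete to K and
-- anticomplete to I.  With at least three legs, 2P₂- and S₁,₁,₂-freeness pin down how an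
-- R-vertex can attach to the legs, and two module arguments finish the proof:
--   * if v ∈ R saw i_J but not i_L, then k_J together with all such vertices would be a
--     non-trivial module, so an R-vertex sees either all of I or none of it;
--   * for a fixed leg C, the set K ∪ I ∪ {R-vertices seeing k_C but not i_C} is a module
--     (saturation rules out edges to the remaining R-vertices), hence contains every vertex.

open import Defs hiding (sym)
open import Data.Nat using (ℕ; zero; suc; _≤_; s≤s; z≤n) renaming (_<_ to _<ℕ_)
open import Data.Nat.Properties using (≤-trans; <-irrefl; <-≤-trans; ≤-pred)
open import Data.Bool using (Bool; true; false)
open import Data.Bool.Properties using () renaming (_≟_ to _≟ᵇ_)
open import Data.Fin using (Fin; zero; suc; _≟_; _<_; #_)
open import Data.Fin.Properties using (all?; any?; <-cmp; suc-injective)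
open import Data.Fin.Subset using (Subset; _∈_; ∣_∣)
open import Data.Fin.Subset.Properties using (∈⊤; x∈p⇒∣p-x∣<∣p∣; x∈p∧x≢y⇒x∈p-y; p⊂q⇒∣p∣<∣q∣; ∣p∣≤n)
open import Data.Vec using (tabulate; _∷_)
open import Data.Vec.Properties using (lookup∘tabulate; []=⇒lookup; lookup⇒[]=; tabulate-cong)
open import Data.Product using (Σ; _×_; _,_; proj₁; proj₂; map₂; swap)
open import Data.Sum using (_⊎_; inj₁; inj₂)
import Data.Sum as Sum
open import Data.Empty using (⊥; ⊥-elim)
open import Function using (_∘_; case_of_)
open import Function.Definitions using (Injective)
open import Level using (0ℓ)
open import Relation.Binary using (tri<; tri≈; tri>)
open import Relation.Nullary using (¬_; Dec; yes; no; does; ¬?)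
open import Relation.Nullary.Decidable using (from-yes; dec-true; map′; toSum; _×-dec_; _⊎-dec_; _→-dec_)
open import Relation.Unary using (Pred; Decidable)
open import Relation.Binary.PropositionalEquality
  using (_≡_; _≢_; refl; sym; trans; cong; subst; module ≡-Reasoning)

one-member : ∀ {n} {p : Subset n} {x} → x ∈ p → 1 ≤ ∣ p ∣
one-member x∈p = ≤-trans (s≤s z≤n) (x∈p⇒∣p-x∣<∣p∣ x∈p)

two-members : ∀ {n} {p : Subset n} {x y} → x ∈ p → y ∈ p → x ≢ y → 2 ≤ ∣ p ∣
two-members x∈p y∈p x≢y =
  ≤-trans (s≤s (one-member (x∈p∧x≢y⇒x∈p-y y∈p (x≢y ∘ sym)))) (x∈p⇒∣p-x∣<∣p∣ x∈p)

does-true : ∀ {A : Set} (a? : Dec A) → does a? ≡ true → A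
does-true (yes a) _ = a

select : ∀ {n} {P : Pred (Fin n) 0ℓ} → Decidable P → Subset n
select P? = tabulate (λ x → does (P? x))

module _ {n} {P : Pred (Fin n) 0ℓ} (P? : Decidable P) where

  select⁺ : ∀ {x} → P x → x ∈ select P?
  select⁺ {x} px = lookup⇒[]= x _ (trans (lookup∘tabulate _ x) (dec-true (P? x) px))

  select⁻ : ∀ {x} → x ∈ select P? → P x
  select⁻ {x} x∈ = does-true (P? x) (trans (sym (lookup∘tabulate _ x)) ([]=⇒lookup x∈))

cons-suc : ∀ b {m} {p q : Subset m} → ∣ p ∣ ≡ suc ∣ q ∣ → ∣ b ∷ p ∣ ≡ suc ∣ b ∷ q ∣
cons-suc true  e = cong suc e
cons-suc false e = e

∣tabulate∣-switch : ∀ {m} (g f : Fin m → Bool) r → g r ≡ true → f r ≡ false →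
                    (∀ x → x ≢ r → g x ≡ f x) → ∣ tabulate g ∣ ≡ suc ∣ tabulate f ∣
∣tabulate∣-switch g f zero gr fr same = begin
  ∣ g zero ∷ tabulate (g ∘ suc) ∣      ≡⟨ cong (λ b → ∣ b ∷ tabulate (g ∘ suc) ∣) gr ⟩
  suc ∣ tabulate (g ∘ suc) ∣           ≡⟨ cong (suc ∘ ∣_∣) (tabulate-cong (λ x → same (suc x) λ ())) ⟩
  suc ∣ tabulate (f ∘ suc) ∣           ≡⟨ cong (λ b → suc ∣ b ∷ tabulate (f ∘ suc) ∣) (sym fr) ⟩
  suc ∣ f zero ∷ tabulate (f ∘ suc) ∣  ∎
  where open ≡-Reasoning
∣tabulate∣-switch g f (suc r) gr fr same = begin
  ∣ g zero ∷ tabulate (g ∘ suc) ∣      ≡⟨ cong (λ b → ∣ b ∷ tabulate (g ∘ suc) ∣) (same zero λ ()) ⟩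
  ∣ f zero ∷ tabulate (g ∘ suc) ∣
    ≡⟨ cons-suc (f zero) {p = tabulate (g ∘ suc)} {q = tabulate (f ∘ suc)} tail-count ⟩
  suc ∣ f zero ∷ tabulate (f ∘ suc) ∣  ∎
  where
  open ≡-Reasoning
  tail-count : ∣ tabulate (g ∘ suc) ∣ ≡ suc ∣ tabulate (f ∘ suc) ∣
  tail-count = ∣tabulate∣-switch (g ∘ suc) (f ∘ suc) r gr fr (λ x x≢r → same (suc x) (x≢r ∘ suc-injective))

-- Two vertices of an adjacency matrix are twins when they are non-adjacent and have the same
-- neighbours; an adjacency-preserving map can only identify twins.
Twins : ∀ {k} → Adj k → Fin k → Fin k → Set
Twins H i j = H i j ≡ false × (∀ m → H i m ≡ H j m)

twins? : ∀ {k} (H : Adj k) i j → Dec (Twins H i j)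
twins? H i j = (H i j ≟ᵇ false) ×-dec all? (λ m → H i m ≟ᵇ H j m)

Simple : ∀ {k} → Adj k → Set
Simple H = (∀ i j → H i j ≡ H j i) × (∀ i → H i i ≡ false)

simple? : ∀ {k} (H : Adj k) → Dec (Simple H)
simple? H = all? (λ i → all? λ j → H i j ≟ᵇ H j i) ×-dec all? (λ i → H i i ≟ᵇ false)

2P2-twin-free : ∀ {i j} → i ≢ j → ¬ Twins 2P2 i j
2P2-twin-free {i} {j} = from-yes (all? λ i → all? λ j → ¬? (i ≟ j) →-dec ¬? (twins? 2P2 i j)) i j

S112-twins : ∀ {i j} → i ≢ j → Twins S112 i j →
             (i ≡ suc zero × j ≡ suc (suc zero)) ⊎ (i ≡ suc (suc zero) × j ≡ suc zero)
S112-twins {i} {j} i≢j tw = from-yes (all? λ i → all? λ j →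
  (¬? (i ≟ j) ×-dec twins? S112 i j) →-dec
  ((i ≟ suc zero ×-dec j ≟ suc (suc zero)) ⊎-dec (i ≟ suc (suc zero) ×-dec j ≟ suc zero))) i j (i≢j , tw)

module InGraph {n : ℕ} (G : Graph n) where

  infix 4 _~_ _≁_
  _~_ _≁_ : Fin n → Fin n → Set
  u ~ v = adj G u v ≡ true
  u ≁ v = adj G u v ≡ false

  ~-sym : ∀ {u v} → u ~ v → v ~ u
  ~-sym {u} {v} uv = trans (Graph.sym G v u) uv

  ≁-sym : ∀ {u v} → u ≁ v → v ≁ u
  ≁-sym {u} {v} uv = trans (Graph.sym G v u) uv

  adjacency : ∀ u v → u ~ v ⊎ u ≁ v
  adjacency u v with adj G u v
  ... | true  = inj₁ refl
  ... | false = inj₂ refl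

  ~-≁-⊥ : ∀ {u v} → u ~ v → u ≁ v → ⊥
  ~-≁-⊥ uv ¬uv with () ← trans (sym uv) ¬uv

  ~-by : ∀ {u v} → (u ≁ v → ⊥) → u ~ v
  ~-by {u} {v} refute with adjacency u v
  ... | inj₁ uv = uv
  ... | inj₂ ¬uv = ⊥-elim (refute ¬uv)

  ≁-by : ∀ {u v} → (u ~ v → ⊥) → u ≁ v
  ≁-by {u} {v} refute with adjacency u v
  ... | inj₁ uv = ⊥-elim (refute uv)
  ... | inj₂ ¬uv = ¬uv

  ~⇒≢ : ∀ {u v} → u ~ v → u ≢ v
  ~⇒≢ {u} uv refl = ~-≁-⊥ uv (irrefl G u)

  Realises : ∀ {k} → Adj k → (Fin k → Fin n) → Set
  Realises H f = ∀ i j → adj G (f i) (f j) ≡ H i j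

  realises-upper : ∀ {k} {H : Adj k} {f : Fin k → Fin n} → Simple H →
                   (∀ {i j} → i < j → adj G (f i) (f j) ≡ H i j) → Realises H f
  realises-upper {f = f} (H-sym , H-irr) upper i j with <-cmp i j
  ... | tri< i<j _ _ = upper i<j
  ... | tri≈ _ refl _ = trans (irrefl G (f i)) (sym (H-irr i))
  ... | tri> _ _ j<i = trans (Graph.sym G (f i) (f j)) (trans (upper j<i) (H-sym j i))

  realisation-twins : ∀ {k} {H : Adj k} {f : Fin k → Fin n} → Realises H f →
                      ∀ {i j} → f i ≡ f j → Twins H i j
  realisation-twins {H = H} {f} real {i} {j} fi≡fj = non-adjacent , same-neighbours
    where
    open ≡-Reasoning
    non-adjacent : H i j ≡ false
    non-adjacent = begin
      H i j               ≡⟨ sym (real i j) ⟩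
      adj G (f i) (f j)   ≡⟨ cong (adj G (f i)) (sym fi≡fj) ⟩
      adj G (f i) (f i)   ≡⟨ irrefl G (f i) ⟩
      false               ∎
    same-neighbours : ∀ m → H i m ≡ H j m
    same-neighbours m = begin
      H i m               ≡⟨ sym (real i m) ⟩
      adj G (f i) (f m)   ≡⟨ cong (λ x → adj G x (f m)) fi≡fj ⟩
      adj G (f j) (f m)   ≡⟨ real j m ⟩
      H j m               ∎

  induced : ∀ {k} {H : Adj k} {f : Fin k → Fin n} → Realises H f →
            (∀ {i j} → i ≢ j → Twins H i j → f i ≢ f j) → ContainsInduced G H
  induced {f = f} real apart = f , injective , real
    where
    injective : Injective _≡_ _≡_ f
    injective {i} {j} fi≡fj with i ≟ j
    ... | yes i≡j = i≡j
    ... | no i≢j = ⊥-elim (apart i≢j (realisation-twins real fi≡fj) fi≡fj)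

  no-2P2 : Free G 2P2 → ∀ {a b c d} → a ~ b → c ~ d → a ≁ c → a ≁ d → b ≁ c → b ≁ d → ⊥
  no-2P2 free {a} {b} {c} {d} ab cd ac ad bc bd =
    free (induced (realises-upper (from-yes (simple? 2P2)) upper) (λ i≢j tw _ → 2P2-twin-free i≢j tw))
    where
    f : Fin 4 → Fin n
    f zero = a
    f (suc zero) = b
    f (suc (suc zero)) = c
    f (suc (suc (suc zero))) = d
    upper : ∀ {i j} → i < j → adj G (f i) (f j) ≡ 2P2 i j
    upper {zero} {suc zero} _ = ab
    upper {zero} {suc (suc zero)} _ = ac
    upper {zero} {suc (suc (suc zero))} _ = ad
    upper {suc zero} {suc (suc zero)} _ = bc
    upper {suc zero} {suc (suc (suc zero))} _ = bd
    upper {suc (suc zero)} {suc (suc (suc zero))} _ = cd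
    upper {_} {zero} ()
    upper {suc _} {suc zero} (s≤s ())
    upper {suc (suc _)} {suc (suc zero)} (s≤s (s≤s ()))
    upper {suc (suc (suc _))} {suc (suc (suc zero))} (s≤s (s≤s (s≤s ())))

  no-S112 : Free G S112 → ∀ {a b c d e} → b ≢ c →
            a ~ b → a ~ c → a ~ d → d ~ e →
            a ≁ e → b ≁ c → b ≁ d → b ≁ e → c ≁ d → c ≁ e → ⊥
  no-S112 free {a} {b} {c} {d} {e} b≢c ab ac ad de ae bc bd be cd ce =
    free (induced (realises-upper (from-yes (simple? S112)) upper) apart)
    where
    f : Fin 5 → Fin n
    f zero = a
    f (suc zero) = b
    f (suc (suc zero)) = c
    f (suc (suc (suc zero))) = d
    f (suc (suc (suc (suc zero)))) = e
    upper : ∀ {i j} → i < j → adj G (f i) (f j) ≡ S112 i j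
    upper {zero} {suc zero} _ = ab
    upper {zero} {suc (suc zero)} _ = ac
    upper {zero} {suc (suc (suc zero))} _ = ad
    upper {zero} {suc (suc (suc (suc zero)))} _ = ae
    upper {suc zero} {suc (suc zero)} _ = bc
    upper {suc zero} {suc (suc (suc zero))} _ = bd
    upper {suc zero} {suc (suc (suc (suc zero)))} _ = be
    upper {suc (suc zero)} {suc (suc (suc zero))} _ = cd
    upper {suc (suc zero)} {suc (suc (suc (suc zero)))} _ = ce
    upper {suc (suc (suc zero))} {suc (suc (suc (suc zero)))} _ = de
    upper {_} {zero} ()
    upper {suc _} {suc zero} (s≤s ())
    upper {suc (suc _)} {suc (suc zero)} (s≤s (s≤s ()))
    upper {suc (suc (suc _))} {suc (suc (suc zero))} (s≤s (s≤s (s≤s ())))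
    upper {suc (suc (suc (suc _)))} {suc (suc (suc (suc zero)))} (s≤s (s≤s (s≤s (s≤s ()))))
    apart : ∀ {i j} → i ≢ j → Twins S112 i j → f i ≢ f j
    apart i≢j tw with S112-twins i≢j tw
    ... | inj₁ (refl , refl) = b≢c
    ... | inj₂ (refl , refl) = b≢c ∘ sym

  Uniform : Pred (Fin n) 0ℓ → Fin n → Set
  Uniform P w = (∀ u → P u → w ~ u) ⊎ (∀ u → P u → w ≁ u)

  Modular : Pred (Fin n) 0ℓ → Set
  Modular P = ∀ w → ¬ P w → Uniform P w

  select-module : ∀ {P} (P? : Decidable P) → Modular P → IsModule G (select P?)
  select-module P? modular w w∉ =
    Sum.map (λ all u u∈ → all u (select⁻ P? u∈)) (λ none u u∈ → none u (select⁻ P? u∈))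
            (modular w (w∉ ∘ select⁺ P?))

  prime-modular : Prime G → ∀ {P} (P? : Decidable P) → Modular P →
                  ∀ {x y} → P x → P y → x ≢ y → ∀ z → P z
  prime-modular prime P? modular px py x≢y z with prime (select P?) (select-module P? modular)
  ... | inj₁ ∣M∣≤1 =
    ⊥-elim (<-irrefl refl (≤-trans (two-members (select⁺ P? px) (select⁺ P? py) x≢y) ∣M∣≤1))
  ... | inj₂ M≡⊤  = select⁻ P? (subst (z ∈_) (sym M≡⊤) ∈⊤)

Labelling : ℕ → Set
Labelling n = Fin n → Part

_≟ₚ_ : (p q : Part) → Dec (p ≡ q)
K ≟ₚ K = yes refl
I ≟ₚ I = yes refl
R ≟ₚ R = yes refl
K ≟ₚ I = no λ ()
K ≟ₚ R = no λ ()
I ≟ₚ K = no λ ()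
I ≟ₚ R = no λ ()
R ≟ₚ K = no λ ()
R ≟ₚ I = no λ ()

isPart-sound : ∀ p q → isPart p q ≡ true → p ≡ q
isPart-sound K K _ = refl
isPart-sound I I _ = refl
isPart-sound R R _ = refl
isPart-sound K I ()
isPart-sound K R ()
isPart-sound I K ()
isPart-sound I R ()
isPart-sound R K ()
isPart-sound R I ()

isPart-refl : ∀ p → isPart p p ≡ true
isPart-refl K = refl
isPart-refl I = refl
isPart-refl R = refl

module _ {n} {ℓ : Labelling n} {p : Part} where

  ∈partSet⁺ : ∀ {x} → ℓ x ≡ p → x ∈ partSet ℓ p
  ∈partSet⁺ {x} ℓx≡p = lookup⇒[]= x _
    (trans (lookup∘tabulate _ x) (subst (λ q → isPart q p ≡ true) (sym ℓx≡p) (isPart-refl p)))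

  ∈partSet⁻ : ∀ {x} → x ∈ partSet ℓ p → ℓ x ≡ p
  ∈partSet⁻ {x} x∈ = isPart-sound (ℓ x) p (trans (sym (lookup∘tabulate _ x)) ([]=⇒lookup x∈))

labels-differ : ∀ {n} {ℓ : Labelling n} {x y p q} → ℓ x ≡ p → ℓ y ≡ q → p ≢ q → x ≢ y
labels-differ ℓx≡p ℓy≡q p≢q refl = p≢q (trans (sym ℓx≡p) ℓy≡q)

extend : ∀ {n} → Labelling n → Fin n → Fin n → Labelling n
extend ℓ r z x with x ≟ r | x ≟ z
... | yes _ | _     = K
... | no _  | yes _ = I
... | no _  | no _  = ℓ x

module ExtendLabels {n} (ℓ : Labelling n) (r z : Fin n) where

  extend-r : extend ℓ r z r ≡ K
  extend-r with r ≟ r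
  ... | yes _   = refl
  ... | no r≢r = ⊥-elim (r≢r refl)

  extend-z : r ≢ z → extend ℓ r z z ≡ I
  extend-z r≢z with z ≟ r | z ≟ z
  ... | yes z≡r | _      = ⊥-elim (r≢z (sym z≡r))
  ... | no _    | yes _   = refl
  ... | no _    | no z≢z = ⊥-elim (z≢z refl)

  extend-other : ∀ {x} → x ≢ r → x ≢ z → extend ℓ r z x ≡ ℓ x
  extend-other {x} x≢r x≢z with x ≟ r | x ≟ z
  ... | yes x≡r | _       = ⊥-elim (x≢r x≡r)
  ... | no _    | yes x≡z = ⊥-elim (x≢z x≡z)
  ... | no _    | no _    = refl

  extend-K⁻ : ∀ x → extend ℓ r z x ≡ K → x ≡ r ⊎ ℓ x ≡ K
  extend-K⁻ x e with x ≟ r | x ≟ z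
  extend-K⁻ x e  | yes x≡r | _     = inj₁ x≡r
  extend-K⁻ x () | no _    | yes _
  extend-K⁻ x e  | no _    | no _  = inj₂ e

  extend-I⁻ : ∀ x → extend ℓ r z x ≡ I → x ≡ z ⊎ ℓ x ≡ I
  extend-I⁻ x e with x ≟ r | x ≟ z
  extend-I⁻ x () | yes _ | _
  extend-I⁻ x e  | no _  | yes x≡z = inj₁ x≡z
  extend-I⁻ x e  | no _  | no _    = inj₂ e

  extend-keeps : ℓ r ≡ R → ℓ z ≡ R → ∀ {x p} → p ≢ R → ℓ x ≡ p → extend ℓ r z x ≡ p
  extend-keeps r∈R z∈R p≢R ℓx≡p =
    trans (extend-other (labels-differ ℓx≡p r∈R p≢R) (labels-differ ℓx≡p z∈R p≢R)) ℓx≡p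

module Spiders {n : ℕ} (G : Graph n) where
  open InGraph G

  record PartialSpider (ℓ : Labelling n) : Set where
    field
      clique      : ∀ u v → ℓ u ≡ K → ℓ v ≡ K → u ≢ v → u ~ v
      independent : ∀ u v → ℓ u ≡ I → ℓ v ≡ I → u ≁ v
      matchK      : ∀ v → ℓ v ≡ K → UniqueNbrIn G ℓ I v
      matchI      : ∀ v → ℓ v ≡ I → UniqueNbrIn G ℓ K v
      balanced    : ∣ partSet ℓ K ∣ ≡ ∣ partSet ℓ I ∣

  empty-spider : PartialSpider (λ _ → R)
  empty-spider = record
    { clique = λ _ _ () ; independent = λ _ _ () ; matchK = λ _ () ; matchI = λ _ () ; balanced = refl }

  record Extendable (ℓ : Labelling n) (r z : Fin n) : Set where
    constructor extendable
    field
      r∈R          : ℓ r ≡ R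
      z∈R          : ℓ z ≡ R
      r~z          : r ~ z
      r-complete-K : ∀ u → ℓ u ≡ K → r ~ u
      r-anti-I     : ∀ u → ℓ u ≡ I → r ≁ u
      z-anti-K     : ∀ u → ℓ u ≡ K → z ≁ u
      z-anti-I     : ∀ u → ℓ u ≡ I → z ≁ u

  extendable? : ∀ ℓ r z → Dec (Extendable ℓ r z)
  extendable? ℓ r z =
    map′ (λ (a , b , c , d , e , f , g) → extendable a b c d e f g)
         (λ (extendable a b c d e f g) → a , b , c , d , e , f , g)
         ( (ℓ r ≟ₚ R) ×-dec (ℓ z ≟ₚ R) ×-dec (adj G r z ≟ᵇ true)
         ×-dec all? (λ u → (ℓ u ≟ₚ K) →-dec (adj G r u ≟ᵇ true))
         ×-dec all? (λ u → (ℓ u ≟ₚ I) →-dec (adj G r u ≟ᵇ false))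
         ×-dec all? (λ u → (ℓ u ≟ₚ K) →-dec (adj G z u ≟ᵇ false))
         ×-dec all? (λ u → (ℓ u ≟ₚ I) →-dec (adj G z u ≟ᵇ false)))

  Saturated : Labelling n → Set
  Saturated ℓ = ∀ r z → ¬ Extendable ℓ r z

  module Extension {ℓ : Labelling n} {r z : Fin n} (sp : PartialSpider ℓ) (ext : Extendable ℓ r z) where
    open PartialSpider sp
    open Extendable ext
    open ExtendLabels ℓ r z

    ℓ′ : Labelling n
    ℓ′ = extend ℓ r z

    r≢z : r ≢ z
    r≢z = ~⇒≢ r~z

    keepsK : ∀ {x} → ℓ x ≡ K → ℓ′ x ≡ K
    keepsK = extend-keeps r∈R z∈R λ ()

    keepsI : ∀ {x} → ℓ x ≡ I → ℓ′ x ≡ I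
    keepsI = extend-keeps r∈R z∈R λ ()

    clique′ : ∀ u v → ℓ′ u ≡ K → ℓ′ v ≡ K → u ≢ v → u ~ v
    clique′ u v u∈K v∈K u≢v with extend-K⁻ u u∈K | extend-K⁻ v v∈K
    ... | inj₁ refl | inj₁ refl = ⊥-elim (u≢v refl)
    ... | inj₁ refl | inj₂ v∈K₀ = r-complete-K v v∈K₀
    ... | inj₂ u∈K₀ | inj₁ refl = ~-sym (r-complete-K u u∈K₀)
    ... | inj₂ u∈K₀ | inj₂ v∈K₀ = clique u v u∈K₀ v∈K₀ u≢v

    independent′ : ∀ u v → ℓ′ u ≡ I → ℓ′ v ≡ I → u ≁ v
    independent′ u v u∈I v∈I with extend-I⁻ u u∈I | extend-I⁻ v v∈I
    ... | inj₁ refl | inj₁ refl = irrefl G z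
    ... | inj₁ refl | inj₂ v∈I₀ = z-anti-I v v∈I₀
    ... | inj₂ u∈I₀ | inj₁ refl = ≁-sym (z-anti-I u u∈I₀)
    ... | inj₂ u∈I₀ | inj₂ v∈I₀ = independent u v u∈I₀ v∈I₀

    matchK′ : ∀ v → ℓ′ v ≡ K → UniqueNbrIn G ℓ′ I v
    matchK′ v v∈K with extend-K⁻ v v∈K
    ... | inj₁ refl = z , extend-z r≢z , r~z , only-z
      where
      only-z : ∀ w → ℓ′ w ≡ I → r ~ w → w ≡ z
      only-z w w∈I r~w with extend-I⁻ w w∈I
      ... | inj₁ w≡z  = w≡z
      ... | inj₂ w∈I₀ = ⊥-elim (~-≁-⊥ r~w (r-anti-I w w∈I₀))
    ... | inj₂ v∈K₀ with matchK v v∈K₀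
    ...   | m , m∈I , v~m , unique = m , keepsI m∈I , v~m , only-m
      where
      only-m : ∀ w → ℓ′ w ≡ I → v ~ w → w ≡ m
      only-m w w∈I v~w with extend-I⁻ w w∈I
      ... | inj₁ refl = ⊥-elim (~-≁-⊥ (~-sym v~w) (z-anti-K v v∈K₀))
      ... | inj₂ w∈I₀ = unique w w∈I₀ v~w

    matchI′ : ∀ v → ℓ′ v ≡ I → UniqueNbrIn G ℓ′ K v
    matchI′ v v∈I with extend-I⁻ v v∈I
    ... | inj₁ refl = r , extend-r , ~-sym r~z , only-r
      where
      only-r : ∀ w → ℓ′ w ≡ K → z ~ w → w ≡ r
      only-r w w∈K z~w with extend-K⁻ w w∈K
      ... | inj₁ w≡r  = w≡r
      ... | inj₂ w∈K₀ = ⊥-elim (~-≁-⊥ z~w (z-anti-K w w∈K₀))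
    ... | inj₂ v∈I₀ with matchI v v∈I₀
    ...   | m , m∈K , v~m , unique = m , keepsK m∈K , v~m , only-m
      where
      only-m : ∀ w → ℓ′ w ≡ K → v ~ w → w ≡ m
      only-m w w∈K v~w with extend-K⁻ w w∈K
      ... | inj₁ refl = ⊥-elim (~-≁-⊥ (~-sym v~w) (r-anti-I v v∈I₀))
      ... | inj₂ w∈K₀ = unique w w∈K₀ v~w

    moreK : ∣ partSet ℓ′ K ∣ ≡ suc ∣ partSet ℓ K ∣
    moreK = ∣tabulate∣-switch _ _ r (cong inK extend-r) (cong inK r∈R) same
      where
      inK : Part → Bool
      inK p = isPart p K
      same : ∀ x → x ≢ r → inK (ℓ′ x) ≡ inK (ℓ x)
      same x x≢r with toSum (x ≟ z)
      ... | inj₁ refl = trans (cong inK (extend-z r≢z)) (cong inK (sym z∈R))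
      ... | inj₂ x≢z = cong inK (extend-other x≢r x≢z)

    moreI : ∣ partSet ℓ′ I ∣ ≡ suc ∣ partSet ℓ I ∣
    moreI = ∣tabulate∣-switch _ _ z (cong inI (extend-z r≢z)) (cong inI z∈R) same
      where
      inI : Part → Bool
      inI p = isPart p I
      same : ∀ x → x ≢ z → inI (ℓ′ x) ≡ inI (ℓ x)
      same x x≢z with toSum (x ≟ r)
      ... | inj₁ refl = trans (cong inI extend-r) (cong inI (sym r∈R))
      ... | inj₂ x≢r = cong inI (extend-other x≢r x≢z)

    extend-spider : PartialSpider ℓ′
    extend-spider = record
      { clique = clique′ ; independent = independent′ ; matchK = matchK′ ; matchI = matchI′
      ; balanced = trans moreK (trans (cong suc balanced) (sym moreI)) }

    fewer-R : ∣ partSet ℓ′ R ∣ <ℕ ∣ partSet ℓ R ∣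
    fewer-R = p⊂q⇒∣p∣<∣q∣ (shrinks , r , ∈partSet⁺ r∈R , r∉)
      where
      r∉ : ¬ r ∈ partSet ℓ′ R
      r∉ r∈ with () ← trans (sym extend-r) (∈partSet⁻ r∈)
      shrinks : ∀ {x} → x ∈ partSet ℓ′ R → x ∈ partSet ℓ R
      shrinks {x} x∈ = ∈partSet⁺ (trans (sym (extend-other x≢r x≢z)) x∈R)
        where
        x∈R : ℓ′ x ≡ R
        x∈R = ∈partSet⁻ x∈
        x≢r : x ≢ r
        x≢r = labels-differ {ℓ = ℓ′} {x} {r} x∈R extend-r λ ()
        x≢z : x ≢ z
        x≢z = labels-differ {ℓ = ℓ′} {x} {z} x∈R (extend-z r≢z) λ ()

  Saturation : Labelling n → Set
  Saturation ℓ = Σ (Labelling n) λ ℓ′ → PartialSpider ℓ′ × Saturated ℓ′ × (∀ x → ℓ x ≡ K → ℓ′ x ≡ K)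

  -- Add legs while possible; each step removes a vertex from R, so this terminates.
  saturate : ∀ {ℓ} → PartialSpider ℓ → Saturation ℓ
  saturate {ℓ} sp = grow (suc n) sp (λ _ ℓx≡K → ℓx≡K) (s≤s (∣p∣≤n (partSet ℓ R)))
    where
    grow : ∀ fuel {ℓ₁} → PartialSpider ℓ₁ → (∀ x → ℓ x ≡ K → ℓ₁ x ≡ K) →
           ∣ partSet ℓ₁ R ∣ <ℕ fuel → Saturation ℓ
    grow (suc fuel) {ℓ₁} sp₁ grown bound with any? (λ r → any? (λ z → extendable? ℓ₁ r z))
    ... | yes (r , z , ext) =
      grow fuel extend-spider (λ x → keepsK ∘ grown x) (<-≤-trans fewer-R (≤-pred bound))
      where open Extension sp₁ ext
    ... | no none = ℓ₁ , sp₁ , (λ r z ext → none (r , z , ext)) , grown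

  -- Three distinct K-vertices; three legs are what the attachment lemmas need.
  record Triangle (ℓ : Labelling n) : Set where
    field
      c₁ c₂ c₃ : Fin n
      c₁∈K : ℓ c₁ ≡ K
      c₂∈K : ℓ c₂ ≡ K
      c₃∈K : ℓ c₃ ≡ K
      c₁≢c₂ : c₁ ≢ c₂
      c₁≢c₃ : c₁ ≢ c₃
      c₂≢c₃ : c₂ ≢ c₃

  triangle-grows : ∀ {ℓ ℓ′} → (∀ x → ℓ x ≡ K → ℓ′ x ≡ K) → Triangle ℓ → Triangle ℓ′
  triangle-grows grown t = record
    { c₁∈K = grown _ c₁∈K ; c₂∈K = grown _ c₂∈K ; c₃∈K = grown _ c₃∈K
    ; c₁≢c₂ = c₁≢c₂ ; c₁≢c₃ = c₁≢c₃ ; c₂≢c₃ = c₂≢c₃ }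
    where open Triangle t

module Structure {n : ℕ} (G : Graph n) (2P2-free : Free G 2P2) (S112-free : Free G S112)
                 {ℓ : Labelling n} (sp : Spiders.PartialSpider G ℓ) (tri : Spiders.Triangle G ℓ) where
  open InGraph G
  open Spiders G
  open PartialSpider sp
  open Triangle tri

  record Leg : Set where
    constructor leg
    field
      k i : Fin n
      k∈K : ℓ k ≡ K
      i∈I : ℓ i ≡ I
      k~i : k ~ i
  open Leg

  leg-at-K : ∀ v → ℓ v ≡ K → Leg
  leg-at-K v v∈K = let (m , m∈I , v~m , _) = matchK v v∈K in leg v m v∈K m∈I v~m

  leg-at-I : ∀ v → ℓ v ≡ I → Leg
  leg-at-I v v∈I = let (m , m∈K , v~m , _) = matchI v v∈I in leg m v m∈K v∈I (~-sym v~m)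

  infix 4 _≉_
  _≉_ : Leg → Leg → Set
  A ≉ B = k A ≢ k B

  I-nbr-unique : ∀ {a b c} → ℓ a ≡ K → ℓ b ≡ I → ℓ c ≡ I → a ~ b → a ~ c → b ≡ c
  I-nbr-unique a∈K b∈I c∈I ab ac =
    let (_ , _ , _ , unique) = matchK _ a∈K in trans (unique _ b∈I ab) (sym (unique _ c∈I ac))

  K-nbr-unique : ∀ {a b c} → ℓ a ≡ I → ℓ b ≡ K → ℓ c ≡ K → a ~ b → a ~ c → b ≡ c
  K-nbr-unique a∈I b∈K c∈K ab ac =
    let (_ , _ , _ , unique) = matchI _ a∈I in trans (unique _ b∈K ab) (sym (unique _ c∈K ac))

  same-k⇒same-i : ∀ A B → k A ≡ k B → i A ≡ i B
  same-k⇒same-i A B kA≡kB =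
    I-nbr-unique (k∈K A) (i∈I A) (i∈I B) (k~i A) (subst (_~ i B) (sym kA≡kB) (k~i B))

  k~k : ∀ A B → A ≉ B → k A ~ k B
  k~k A B = clique (k A) (k B) (k∈K A) (k∈K B)

  i≁i : ∀ A B → i A ≁ i B
  i≁i A B = independent (i A) (i B) (i∈I A) (i∈I B)

  i≢i : ∀ A B → A ≉ B → i A ≢ i B
  i≢i A B A≉B iA≡iB =
    A≉B (K-nbr-unique (i∈I B) (k∈K A) (k∈K B) (subst (_~ k A) iA≡iB (~-sym (k~i A))) (~-sym (k~i B)))

  k≁i : ∀ A B → A ≉ B → k A ≁ i B
  k≁i A B A≉B = ≁-by λ kA~iB → i≢i A B A≉B (I-nbr-unique (k∈K A) (i∈I A) (i∈I B) (k~i A) kA~iB)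

  avoid : ∀ {x y : Fin n} → x ≢ y → ∀ a → x ≢ a ⊎ y ≢ a
  avoid {x} x≢y a with x ≟ a
  ... | yes refl = inj₂ (x≢y ∘ sym)
  ... | no x≢a  = inj₁ x≢a

  avoiding-c₁ : ∀ d → Σ Leg λ T → k T ≢ c₁ × k T ≢ d
  avoiding-c₁ d with avoid c₂≢c₃ d
  ... | inj₁ c₂≢d = leg-at-K c₂ c₂∈K , c₁≢c₂ ∘ sym , c₂≢d
  ... | inj₂ c₃≢d = leg-at-K c₃ c₃∈K , c₁≢c₃ ∘ sym , c₃≢d

  third-leg : ∀ a b → Σ Leg λ T → k T ≢ a × k T ≢ b
  third-leg a b with c₁ ≟ a | c₁ ≟ b
  ... | no c₁≢a | no c₁≢b = leg-at-K c₁ c₁∈K , c₁≢a , c₁≢b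
  ... | yes refl | _      = avoiding-c₁ b
  ... | no _ | yes refl   = map₂ swap (avoiding-c₁ a)

  i≢k : ∀ A B → i A ≢ k B
  i≢k A B = labels-differ (i∈I A) (k∈K B) λ ()

  i≢R : ∀ A {v} → ℓ v ≡ R → i A ≢ v
  i≢R A v∈R = labels-differ (i∈I A) v∈R λ ()

  -- A vertex adjacent to i_L is adjacent to k_J for every other leg J: otherwise, with a
  -- third leg T, an induced 2P2 or S112 appears among w, i_L, k_J, i_J, k_T, i_T.
  sees-i⇒sees-k : ∀ J L → J ≉ L → ∀ {w} → w ~ i L → w ~ k J
  sees-i⇒sees-k J L J≉L {w} w~iL = ~-by λ w≁kJ →
    by-third-leg w≁kJ (adjacency w (i T)) (adjacency w (i J)) (adjacency w (k T))
    where
    T : Leg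
    T = proj₁ (third-leg (k J) (k L))
    T≉J : T ≉ J
    T≉J = proj₁ (proj₂ (third-leg (k J) (k L)))
    T≉L : T ≉ L
    T≉L = proj₂ (proj₂ (third-leg (k J) (k L)))
    by-third-leg : w ≁ k J → w ~ i T ⊎ w ≁ i T → w ~ i J ⊎ w ≁ i J → w ~ k T ⊎ w ≁ k T → ⊥
    by-third-leg w≁kJ (inj₁ w~iT) (inj₁ w~iJ) _ =
      no-S112 S112-free (i≢i L T (T≉L ∘ sym)) w~iL w~iT w~iJ (~-sym (k~i J))
        w≁kJ (i≁i L T) (i≁i L J) (≁-sym (k≁i J L J≉L)) (i≁i T J) (≁-sym (k≁i J T (T≉J ∘ sym)))
    by-third-leg w≁kJ (inj₁ _) (inj₂ w≁iJ) _ =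
      no-2P2 2P2-free (k~i J) (~-sym w~iL) (k≁i J L J≉L) (≁-sym w≁kJ) (i≁i J L) (≁-sym w≁iJ)
    by-third-leg w≁kJ (inj₂ w≁iT) _ (inj₁ w~kT) =
      no-S112 S112-free (i≢k T J ∘ sym) (k~k T J T≉J) (k~i T) (~-sym w~kT) w~iL
        (k≁i T L T≉L) (k≁i J T (T≉J ∘ sym)) (≁-sym w≁kJ) (k≁i J L J≉L) (≁-sym w≁iT) (i≁i T L)
    by-third-leg w≁kJ (inj₂ w≁iT) _ (inj₂ w≁kT) =
      no-2P2 2P2-free (k~k J T (T≉J ∘ sym)) (~-sym w~iL)
        (k≁i J L J≉L) (≁-sym w≁kJ) (k≁i T L T≉L) (≁-sym w≁kT)

  -- A vertex seeing i_J but missing i_L misses i_T for every other leg T (else S112 at v).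
  sees-i-misses-i⇒misses-other-i : ∀ J L → J ≉ L → ∀ {v} → v ~ i J → v ≁ i L → ∀ T → T ≉ J → v ≁ i T
  sees-i-misses-i⇒misses-other-i J L J≉L {v} v~iJ v≁iL T T≉J with k T ≟ k L
  ... | yes kT≡kL = subst (v ≁_) (sym (same-k⇒same-i T L kT≡kL)) v≁iL
  ... | no T≉L = ≁-by λ v~iT →
    no-S112 S112-free (i≢i J T (T≉J ∘ sym)) v~iJ v~iT v~kL (k~i L)
      v≁iL (i≁i J T) (≁-sym (k≁i L J (J≉L ∘ sym))) (i≁i J L) (≁-sym (k≁i L T (T≉L ∘ sym))) (i≁i T L)
    where
    v~kL : v ~ k L
    v~kL = sees-i⇒sees-k L J (J≉L ∘ sym) v~iJ

  -- An R-vertex missing i_A and i_B sees k_A only if it sees k_B (else S112 at k_A).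
  misses-i⇒same-k : ∀ A B → A ≉ B → ∀ {v} → ℓ v ≡ R → v ≁ i A → v ≁ i B → v ~ k A → v ~ k B
  misses-i⇒same-k A B A≉B v∈R v≁iA v≁iB v~kA = ~-by λ v≁kB →
    no-S112 S112-free (i≢R A v∈R) (k~i A) (~-sym v~kA) (k~k A B A≉B) (k~i B)
      (k≁i A B A≉B) (≁-sym v≁iA) (≁-sym (k≁i B A (A≉B ∘ sym))) (i≁i A B) v≁kB v≁iB

  -- A vertex seeing i_A, i_B and k_C is adjacent to every vertex seeing k_C but missing
  -- i_A and i_B (else S112 at w).
  sees-i-i-k⇒adjacent : ∀ A B C → A ≉ B → C ≉ A → C ≉ B → ∀ {w x} →
                         w ~ i A → w ~ i B → w ~ k C → x ~ k C → x ≁ i A → x ≁ i B → w ~ x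
  sees-i-i-k⇒adjacent A B C A≉B C≉A C≉B w~iA w~iB w~kC x~kC x≁iA x≁iB = ~-by λ w≁x →
    no-S112 S112-free (i≢i A B A≉B) w~iA w~iB w~kC (~-sym x~kC)
      w≁x (i≁i A B) (≁-sym (k≁i C A C≉A)) (≁-sym x≁iA) (≁-sym (k≁i C B C≉B)) (≁-sym x≁iB)

  -- If w sees i_L but misses i_J, then w ~ x (else x i_J, w i_L is an induced 2P2).
  crossing : ∀ J L → ∀ {x w} → x ~ i J → x ≁ i L → w ~ i L → w ≁ i J → w ~ x
  crossing J L x~iJ x≁iL w~iL w≁iJ = ~-by λ w≁x →
    no-2P2 2P2-free (~-sym x~iJ) (~-sym w~iL) (i≁i J L) (≁-sym w≁iJ) x≁iL (≁-sym w≁x)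

  -- An R-vertex w missing i_J but seeing k_J sees x (else S112 at k_L).
  pendant-join : ∀ J L → J ≉ L → ∀ {x w} → ℓ w ≡ R → x ~ i J → x ≁ i L → w ≁ i J → w ~ k J → w ~ x
  pendant-join J L J≉L {x} {w} w∈R x~iJ x≁iL w≁iJ w~kJ with adjacency w (i L)
  ... | inj₁ w~iL = crossing J L x~iJ x≁iL w~iL w≁iJ
  ... | inj₂ w≁iL = ~-by λ w≁x →
    no-S112 S112-free (i≢R L w∈R) (k~i L) (~-sym w~kL) (~-sym x~kL) x~iJ
      (k≁i L J (J≉L ∘ sym)) (≁-sym w≁iL) (≁-sym x≁iL) (i≁i L J) w≁x w≁iJ
    where
    w~kL : w ~ k L
    w~kL = misses-i⇒same-k J L J≉L w∈R w≁iJ w≁iL w~kJ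
    x~kL : x ~ k L
    x~kL = sees-i⇒sees-k L J (J≉L ∘ sym) x~iJ

  -- An R-vertex w missing both i_J and k_J misses x (else S112 at x).
  pendant-split : ∀ J L → J ≉ L → ∀ {x w} → ℓ w ≡ R → x ~ i J → x ≁ i L → w ≁ i J → w ≁ k J → w ≁ x
  pendant-split J L J≉L {x} {w} w∈R x~iJ x≁iL w≁iJ w≁kJ = ≁-by λ w~x →
    no-S112 S112-free (i≢R J w∈R) x~iJ (~-sym w~x) x~kL (k~i L)
      x≁iL (≁-sym w≁iJ) (≁-sym (k≁i L J (J≉L ∘ sym))) (i≁i J L) w≁kL w≁iL
    where
    w≁iL : w ≁ i L
    w≁iL = ≁-by λ w~iL → ~-≁-⊥ (sees-i⇒sees-k J L J≉L w~iL) w≁kJ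
    w≁kL : w ≁ k L
    w≁kL = ≁-by λ w~kL → ~-≁-⊥ (misses-i⇒same-k L J (J≉L ∘ sym) w∈R w≁iL w≁iJ w~kL) w≁kJ
    x~kL : x ~ k L
    x~kL = sees-i⇒sees-k L J (J≉L ∘ sym) x~iJ

  -- If x is in R, every w seeing i_L sees x (else S112 at w or at k_T, T a third leg).
  pendant-meets : ∀ J L → J ≉ L → ∀ {x w} → ℓ x ≡ R → x ~ i J → x ≁ i L → w ~ i L → w ~ x
  pendant-meets J L J≉L {x} {w} x∈R x~iJ x≁iL w~iL = ~-by refute
    where
    T : Leg
    T = proj₁ (third-leg (k J) (k L))
    T≉J : T ≉ J
    T≉J = proj₁ (proj₂ (third-leg (k J) (k L)))
    T≉L : T ≉ L
    T≉L = proj₂ (proj₂ (third-leg (k J) (k L)))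
    x~kT : x ~ k T
    x~kT = sees-i⇒sees-k T J T≉J x~iJ
    x≁iT : x ≁ i T
    x≁iT = sees-i-misses-i⇒misses-other-i J L J≉L x~iJ x≁iL T T≉J
    w~kT : w ~ k T
    w~kT = sees-i⇒sees-k T L T≉L w~iL
    refute : w ≁ x → ⊥
    refute w≁x with adjacency w (i T) | adjacency w (i J)
    ... | _ | inj₂ w≁iJ = ~-≁-⊥ (crossing J L x~iJ x≁iL w~iL w≁iJ) w≁x
    ... | inj₁ w~iT | inj₁ w~iJ =
      no-S112 S112-free (i≢i L T (T≉L ∘ sym)) w~iL w~iT w~iJ (~-sym x~iJ)
        w≁x (i≁i L T) (i≁i L J) (≁-sym x≁iL) (i≁i T J) (≁-sym x≁iT)
    ... | inj₂ w≁iT | inj₁ _ =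
      no-S112 S112-free (i≢R T x∈R) (k~i T) (~-sym x~kT) (~-sym w~kT) w~iL
        (k≁i T L T≉L) (≁-sym x≁iT) (≁-sym w≁iT) (i≁i T L) (≁-sym w≁x) x≁iL

  module _ (prime : Prime G) where

    Pendant : Leg → Leg → Fin n → Set
    Pendant J L x = x ≡ k J ⊎ (ℓ x ≡ R × x ~ i J × x ≁ i L)

    pendant? : ∀ J L → Decidable (Pendant J L)
    pendant? J L x =
      (x ≟ k J) ⊎-dec ((ℓ x ≟ₚ R) ×-dec (adj G x (i J) ≟ᵇ true) ×-dec (adj G x (i L) ≟ᵇ false))

    -- The pendant vertices form a module: vertices of K other than k_J see all of them, i_J
    -- sees all of them, the other vertices of I see none, and R-vertices are settled by the
    -- four lemmas above.
    pendant-K : ∀ J L W → W ≉ J → Uniform (Pendant J L) (k W)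
    pendant-K J L W W≉J = inj₁ λ
      { _ (inj₁ refl) → k~k W J W≉J
      ; _ (inj₂ (_ , u~iJ , _)) → ~-sym (sees-i⇒sees-k W J W≉J u~iJ) }

    pendant-I : ∀ J L → J ≉ L → ∀ W → Uniform (Pendant J L) (i W)
    pendant-I J L J≉L W with k W ≟ k J
    ... | yes kW≡kJ = inj₁ λ
      { _ (inj₁ refl) → subst (_~ k J) (sym (same-k⇒same-i W J kW≡kJ)) (~-sym (k~i J))
      ; u (inj₂ (_ , u~iJ , _)) → subst (_~ u) (sym (same-k⇒same-i W J kW≡kJ)) (~-sym u~iJ) }
    ... | no W≉J = inj₂ λ
      { _ (inj₁ refl) → ≁-sym (k≁i J W (W≉J ∘ sym))
      ; _ (inj₂ (_ , u~iJ , u≁iL)) → ≁-sym (sees-i-misses-i⇒misses-other-i J L J≉L u~iJ u≁iL W W≉J) }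

    pendant-R : ∀ J L → J ≉ L → ∀ {w} → ℓ w ≡ R → ¬ (w ~ i J × w ≁ i L) → Uniform (Pendant J L) w
    pendant-R J L J≉L {w} w∈R w∉ with adjacency w (i L) | adjacency w (i J) | adjacency w (k J)
    ... | inj₁ w~iL | _ | _ = inj₁ λ
      { _ (inj₁ refl) → sees-i⇒sees-k J L J≉L w~iL
      ; _ (inj₂ (u∈R , u~iJ , u≁iL)) → pendant-meets J L J≉L u∈R u~iJ u≁iL w~iL }
    ... | inj₂ w≁iL | inj₁ w~iJ | _ = ⊥-elim (w∉ (w~iJ , w≁iL))
    ... | inj₂ _ | inj₂ w≁iJ | inj₁ w~kJ = inj₁ λ
      { _ (inj₁ refl) → w~kJ
      ; _ (inj₂ (_ , u~iJ , u≁iL)) → pendant-join J L J≉L w∈R u~iJ u≁iL w≁iJ w~kJ }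
    ... | inj₂ _ | inj₂ w≁iJ | inj₂ w≁kJ = inj₂ λ
      { _ (inj₁ refl) → w≁kJ
      ; _ (inj₂ (_ , u~iJ , u≁iL)) → pendant-split J L J≉L w∈R u~iJ u≁iL w≁iJ w≁kJ }

    pendant-modular : ∀ J L → J ≉ L → Modular (Pendant J L)
    pendant-modular J L J≉L w w∉ with ℓ w in ℓw
    ... | K = pendant-K J L (leg-at-K w ℓw) (w∉ ∘ inj₁)
    ... | I = pendant-I J L J≉L (leg-at-I w ℓw)
    ... | R = pendant-R J L J≉L ℓw λ (w~iJ , w≁iL) → w∉ (inj₂ (refl , w~iJ , w≁iL))

    -- An R-vertex adjacent to one vertex of I is adjacent to all of them; otherwise the
    -- pendant module would contain k_J and v but not i_J.
    sees-one-i⇒sees-all-i : ∀ {v} → ℓ v ≡ R → ∀ J L → v ~ i J → v ~ i L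
    sees-one-i⇒sees-all-i {v} v∈R J L v~iJ = ~-by λ v≁iL →
      iJ-not-pendant (prime-modular prime (pendant? J L) (pendant-modular J L (J≉L v≁iL))
                        (inj₁ refl) (inj₂ (v∈R , v~iJ , v≁iL)) (labels-differ (k∈K J) v∈R λ ()) (i J))
      where
      J≉L : v ≁ i L → J ≉ L
      J≉L v≁iL kJ≡kL = ~-≁-⊥ v~iJ (subst (v ≁_) (sym (same-k⇒same-i J L kJ≡kL)) v≁iL)
      iJ-not-pendant : ¬ Pendant J L (i J)
      iJ-not-pendant (inj₁ iJ≡kJ) = i≢k J J iJ≡kJ
      iJ-not-pendant (inj₂ (iJ∈R , _)) = i≢R J iJ∈R refl

    C₁ C₂ C₃ : Leg
    C₁ = leg-at-K c₁ c₁∈K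
    C₂ = leg-at-K c₂ c₂∈K
    C₃ = leg-at-K c₃ c₃∈K

    misses-I : ∀ {v} → ℓ v ≡ R → v ≁ i C₁ → ∀ u → ℓ u ≡ I → v ≁ u
    misses-I v∈R v≁iC u u∈I =
      ≁-by λ v~u → ~-≁-⊥ (sees-one-i⇒sees-all-i v∈R (leg-at-I u u∈I) C₁ v~u) v≁iC

    K-uniform : ∀ {v} → ℓ v ≡ R → v ≁ i C₁ → ∀ u u′ → ℓ u ≡ K → ℓ u′ ≡ K → v ~ u → v ~ u′
    K-uniform v∈R v≁iC u u′ u∈K u′∈K v~u with u ≟ u′
    ... | yes refl = v~u
    ... | no u≢u′ = misses-i⇒same-k U U′ u≢u′ v∈R
                      (misses-I v∈R v≁iC (i U) (i∈I U)) (misses-I v∈R v≁iC (i U′) (i∈I U′)) v~u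
      where
      U U′ : Leg
      U  = leg-at-K u u∈K
      U′ = leg-at-K u′ u′∈K

    sees-I⇒sees-K : ∀ {v} → ℓ v ≡ R → v ~ i C₁ → ∀ u → ℓ u ≡ K → v ~ u
    sees-I⇒sees-K v∈R v~iC u u∈K =
      sees-i⇒sees-k U T (T≉U ∘ sym) (sees-one-i⇒sees-all-i v∈R C₁ T v~iC)
      where
      U T : Leg
      U = leg-at-K u u∈K
      T = proj₁ (third-leg u u)
      T≉U : T ≉ U
      T≉U = proj₁ (proj₂ (third-leg u u))

    module _ (saturated : Saturated ℓ) where

      Core : Fin n → Set
      Core x = ℓ x ≡ K ⊎ ℓ x ≡ I ⊎ (ℓ x ≡ R × x ~ k C₁ × x ≁ i C₁)

      core? : Decidable Core
      core? x = (ℓ x ≟ₚ K) ⊎-dec (ℓ x ≟ₚ I)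
                ⊎-dec ((ℓ x ≟ₚ R) ×-dec (adj G x (k C₁) ≟ᵇ true) ×-dec (adj G x (i C₁) ≟ᵇ false))

      -- An R-vertex outside the core that sees i_{C₁} is complete to it (it sees K and I,
      -- and the core R-vertices by sees-i-i-k⇒adjacent); one that misses i_{C₁} misses k_{C₁},
      -- hence all of K ∪ I, and by saturation all core R-vertices.
      core-R : ∀ {w} → ℓ w ≡ R → ¬ (w ~ k C₁ × w ≁ i C₁) → Uniform Core w
      core-R {w} w∈R w∉ with adjacency w (i C₁)
      ... | inj₁ w~iC = inj₁ λ
        { u (inj₁ u∈K) → sees-I⇒sees-K w∈R w~iC u u∈K
        ; u (inj₂ (inj₁ u∈I)) → sees-one-i⇒sees-all-i w∈R C₁ (leg-at-I u u∈I) w~iC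
        ; u (inj₂ (inj₂ (u∈R , u~kC , u≁iC))) →
            sees-i-i-k⇒adjacent C₂ C₃ C₁ c₂≢c₃ c₁≢c₂ c₁≢c₃
              (sees-one-i⇒sees-all-i w∈R C₁ C₂ w~iC) (sees-one-i⇒sees-all-i w∈R C₁ C₃ w~iC)
              (sees-I⇒sees-K w∈R w~iC c₁ c₁∈K)
              u~kC (misses-I u∈R u≁iC (i C₂) (i∈I C₂)) (misses-I u∈R u≁iC (i C₃) (i∈I C₃)) }
      ... | inj₂ w≁iC = inj₂ λ
        { u (inj₁ u∈K) → misses-K u u∈K
        ; u (inj₂ (inj₁ u∈I)) → misses-I w∈R w≁iC u u∈I
        ; u (inj₂ (inj₂ (u∈R , u~kC , u≁iC))) → ≁-by λ w~u →
            saturated u w (extendable u∈R w∈R (~-sym w~u)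
              (λ u′ u′∈K → K-uniform u∈R u≁iC (k C₁) u′ c₁∈K u′∈K u~kC) (misses-I u∈R u≁iC)
              misses-K (misses-I w∈R w≁iC)) }
        where
        misses-K : ∀ u → ℓ u ≡ K → w ≁ u
        misses-K u u∈K = ≁-by λ w~u → w∉ (K-uniform w∈R w≁iC u (k C₁) u∈K c₁∈K w~u , w≁iC)

      core-modular : Modular Core
      core-modular w w∉ with ℓ w in ℓw
      ... | K = ⊥-elim (w∉ (inj₁ refl))
      ... | I = ⊥-elim (w∉ (inj₂ (inj₁ refl)))
      ... | R = core-R ℓw λ (w~kC , w≁iC) → w∉ (inj₂ (inj₂ (refl , w~kC , w≁iC)))

      -- By primality the core is everything: every R-vertex sees k_{C₁} and misses i_{C₁}.
      R-in-core : ∀ {v} → ℓ v ≡ R → v ~ k C₁ × v ≁ i C₁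
      R-in-core {v} v∈R
        with prime-modular prime core? core-modular
               (inj₁ (k∈K C₁)) (inj₂ (inj₁ (i∈I C₁))) (i≢k C₁ C₁ ∘ sym) v
      ... | inj₁ v∈K = ⊥-elim (labels-differ {ℓ = ℓ} v∈K v∈R (λ ()) refl)
      ... | inj₂ (inj₁ v∈I) = ⊥-elim (labels-differ {ℓ = ℓ} v∈I v∈R (λ ()) refl)
      ... | inj₂ (inj₂ (_ , v~kC , v≁iC)) = v~kC , v≁iC

      thin-spider : IsThinSpiderPartition G ℓ
      thin-spider = balanced , two-members (∈partSet⁺ c₁∈K) (∈partSet⁺ c₂∈K) c₁≢c₂ , clique , independent
                  , R-complete-K , R-anti-I , matchK , matchI
        where
        R-complete-K : ∀ u v → ℓ u ≡ R → ℓ v ≡ K → u ~ v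
        R-complete-K u v u∈R v∈K =
          let (u~kC , u≁iC) = R-in-core u∈R in K-uniform u∈R u≁iC (k C₁) v c₁∈K v∈K u~kC
        R-anti-I : ∀ u v → ℓ u ≡ R → ℓ v ≡ I → u ≁ v
        R-anti-I u v u∈R v∈I = misses-I u∈R (proj₂ (R-in-core u∈R)) v v∈I

module NetStart {n : ℕ} (G : Graph n) where
  open InGraph G
  open Spiders G

  -- In an induced net, the triangle b₁b₂b₃ with the matched pendant vertices a₁a₂a₃ is a partial
  -- spider with three legs: it arises from the empty one by adding the legs (bₜ, aₜ) in turn.
  net-spider : ContainsInduced G Net → Σ (Labelling n) λ ℓ → PartialSpider ℓ × Triangle ℓ
  net-spider (f , injective , realises) = ℓ₃ , sp₃ , triangle
    where
    b₁ b₂ b₃ a₁ a₂ a₃ : Fin n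
    b₁ = f (# 0)
    b₂ = f (# 1)
    b₃ = f (# 2)
    a₁ = f (# 3)
    a₂ = f (# 4)
    a₃ = f (# 5)

    apart : ∀ {i j} → i ≢ j → f i ≢ f j
    apart i≢j = i≢j ∘ injective

    ℓ₀ ℓ₁ ℓ₂ ℓ₃ : Labelling n
    ℓ₀ = λ _ → R
    ℓ₁ = extend ℓ₀ b₁ a₁
    ℓ₂ = extend ℓ₁ b₂ a₂
    ℓ₃ = extend ℓ₂ b₃ a₃

    module E₁ = ExtendLabels ℓ₀ b₁ a₁
    module E₂ = ExtendLabels ℓ₁ b₂ a₂
    module E₃ = ExtendLabels ℓ₂ b₃ a₃

    K₁ : ∀ u → ℓ₁ u ≡ K → u ≡ b₁
    K₁ u u∈K with E₁.extend-K⁻ u u∈K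
    ... | inj₁ u≡b₁ = u≡b₁

    I₁ : ∀ u → ℓ₁ u ≡ I → u ≡ a₁
    I₁ u u∈I with E₁.extend-I⁻ u u∈I
    ... | inj₁ u≡a₁ = u≡a₁

    K₂ : ∀ u → ℓ₂ u ≡ K → u ≡ b₂ ⊎ u ≡ b₁
    K₂ u u∈K with E₂.extend-K⁻ u u∈K
    ... | inj₁ u≡b₂ = inj₁ u≡b₂
    ... | inj₂ u∈K₁ = inj₂ (K₁ u u∈K₁)

    I₂ : ∀ u → ℓ₂ u ≡ I → u ≡ a₂ ⊎ u ≡ a₁
    I₂ u u∈I with E₂.extend-I⁻ u u∈I
    ... | inj₁ u≡a₂ = inj₁ u≡a₂
    ... | inj₂ u∈I₁ = inj₂ (I₁ u u∈I₁)

    ext₁ : Extendable ℓ₀ b₁ a₁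
    ext₁ = extendable refl refl (realises (# 0) (# 3)) (λ _ ()) (λ _ ()) (λ _ ()) (λ _ ())

    ext₂ : Extendable ℓ₁ b₂ a₂
    ext₂ = extendable
      (E₁.extend-other (apart λ ()) (apart λ ()))
      (E₁.extend-other (apart λ ()) (apart λ ()))
      (realises (# 1) (# 4))
      (λ u u∈K → case K₁ u u∈K of λ { refl → realises (# 1) (# 0) })
      (λ u u∈I → case I₁ u u∈I of λ { refl → realises (# 1) (# 3) })
      (λ u u∈K → case K₁ u u∈K of λ { refl → realises (# 4) (# 0) })
      (λ u u∈I → case I₁ u u∈I of λ { refl → realises (# 4) (# 3) })

    ext₃ : Extendable ℓ₂ b₃ a₃
    ext₃ = extendable
      (trans (E₂.extend-other (apart λ ()) (apart λ ())) (E₁.extend-other (apart λ ()) (apart λ ())))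
      (trans (E₂.extend-other (apart λ ()) (apart λ ())) (E₁.extend-other (apart λ ()) (apart λ ())))
      (realises (# 2) (# 5))
      (λ u u∈K → case K₂ u u∈K of λ
        { (inj₁ refl) → realises (# 2) (# 1) ; (inj₂ refl) → realises (# 2) (# 0) })
      (λ u u∈I → case I₂ u u∈I of λ
        { (inj₁ refl) → realises (# 2) (# 4) ; (inj₂ refl) → realises (# 2) (# 3) })
      (λ u u∈K → case K₂ u u∈K of λ
        { (inj₁ refl) → realises (# 5) (# 1) ; (inj₂ refl) → realises (# 5) (# 0) })
      (λ u u∈I → case I₂ u u∈I of λ
        { (inj₁ refl) → realises (# 5) (# 4) ; (inj₂ refl) → realises (# 5) (# 3) })

    sp₁ : PartialSpider ℓ₁
    sp₁ = Extension.extend-spider empty-spider ext₁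
    sp₂ : PartialSpider ℓ₂
    sp₂ = Extension.extend-spider sp₁ ext₂
    sp₃ : PartialSpider ℓ₃
    sp₃ = Extension.extend-spider sp₂ ext₃

    triangle : Triangle ℓ₃
    triangle = record
      { c₁ = b₁ ; c₂ = b₂ ; c₃ = b₃
      ; c₁∈K = Extension.keepsK sp₂ ext₃ {b₁} (Extension.keepsK sp₁ ext₂ {b₁} E₁.extend-r)
      ; c₂∈K = Extension.keepsK sp₂ ext₃ {b₂} E₂.extend-r
      ; c₃∈K = E₃.extend-r
      ; c₁≢c₂ = apart λ () ; c₁≢c₃ = apart λ () ; c₂≢c₃ = apart λ () }

lemma26 : {n : ℕ} (G : Graph n) → Prime G → Free G 2P2 → Free G C5 → Free G S112
    → ContainsInduced G Net → IsThinSpider G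
lemma26 G prime 2P2-free _ S112-free net =
  let (ℓ₀ , sp₀ , triangle₀) = NetStart.net-spider G net
      (ℓ , sp , saturated , grown) = Spiders.saturate G sp₀
      triangle = Spiders.triangle-grows G grown triangle₀
  in ℓ , Structure.thin-spider G 2P2-free S112-free sp triangle prime saturated
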